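{- Every finite word that occurs as a factor of $\mathbf{t}_{3/2}$ occurs in $\mathbf{t}_{3/2}$ both at some even position and at some odd position.
   Context: Let $\mathbf{t}_{3/2}=(t_n)_{n\ge0}\in\{0,1\}^{\mathbb{N}}$ be the unique binary sequence with $t_0=0$ such that $t_{3n}=t_{3n+1}=t_{2n}$ and $t_{3n+2}=1-t_{2n+1}$ for all $n\ge0$. A word $u$ occurs at position $i$ if $t_it_{i+1}\cdots t_{i+|u|-1}=u$. -}

module Defs where

open import Data.Nat using (ℕ; zero; suc; _+_; _*_; _<_)
open import Data.Nat.DivMod using (_/_; _%_)
open import Data.Bool using (Bool; true; false; not)
open import Data.List using (List; length; lookup)
open import Data.Fin using (Fin; toℕ)
open import Data.Product using (∃; _×_)
open import Relation.Binary.PropositionalEquality using (_≡_)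

-- Auxiliary recursion with fuel; with fuel > n it computes t_n.
-- 0 is encoded as false, 1 as true.
t-aux : ℕ → ℕ → Bool
t-aux zero    _ = false
t-aux (suc f) zero = false
t-aux (suc f) (suc n) with (suc n) % 3
... | 0 = t-aux f (2 * ((suc n) / 3))
... | 1 = t-aux f (2 * ((suc n) / 3))
... | _ = not (t-aux f (2 * ((suc n) / 3) + 1))

t : ℕ → Bool
t n = t-aux (suc n) n

OccursAt : List Bool → ℕ → Set
OccursAt u i = (k : Fin (length u)) → t (i + toℕ k) ≡ lookup u k

Factor : List Bool → Set
Factor u = ∃ λ i → OccursAt u i

{-# OPTIONS --safe #-}
-- Write the recurrence as t(r + 3n) = [r = 2] xor t(2n + ⌊r/2⌋) for digits r < 3.
-- Unrolling it g times gives t(3^g m + j) = t(j) xor t(2^g m) whenever j ≤ g, since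
-- each step replaces j by 2⌊j/3⌋ + ⌊(j mod 3)/2⌋ ≤ pred j, which reaches 0 in time.
-- So on the window [0, n) the sequence agrees with its shift by 3^g (g ≥ n) up to the
-- constant bit t(2^g). For h = 3^n + n the odd shifts 3^n, 3^(h+1) and 2·3^h + 3^n
-- (the last composed of two) carry the bits t(2^n), t(2^(h+1)) and their xor, so one
-- of them fixes the window exactly: every occurrence at i recurs at i + an odd number.
module Submission where

open import Defs
open import Data.Nat using (ℕ; zero; suc; pred; _+_; _*_; _^_; _≤_; _<_; z≤n; s≤s; s≤s⁻¹; _≡ᵇ_; ⌊_/2⌋)
open import Data.Nat.Properties
open import Data.Nat.DivMod using (_/_; _%_; _divMod_; result; [m+kn]%n≡m%n; m<n⇒m%n≡m; +-distrib-/-∣ʳ; m<n⇒m/n≡0; m*n/n≡m)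
open import Data.Nat.Divisibility using (n∣m*n)
open import Data.Nat.Tactic.RingSolver using (solve-∀)
open import Algebra.Definitions.RawMagma using (_,_)
open import Data.Bool using (Bool; true; false; not; _xor_)
open import Data.Bool.Properties using (xor-assoc; xor-identityʳ)
open import Data.List using (List; length; lookup)
open import Data.Fin using (Fin; zero; suc; toℕ)
open import Data.Fin.Properties using (toℕ<n)
open import Data.Product using (∃; _×_; _,_)
open import Data.Sum using (_⊎_; inj₁; inj₂)
open import Relation.Binary.PropositionalEquality using (_≡_; refl; sym; trans; cong; cong₂; subst; subst₂; module ≡-Reasoning)

open ≡-Reasoning

t-aux-step : ℕ → ℕ → ℕ → Bool
t-aux-step zero          f x = t-aux f (2 * (x / 3))
t-aux-step (suc zero)    f x = t-aux f (2 * (x / 3))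
t-aux-step (suc (suc _)) f x = not (t-aux f (2 * (x / 3) + 1))

t-aux-suc : ∀ f n → t-aux (suc f) (suc n) ≡ t-aux-step (suc n % 3) f (suc n)
t-aux-suc f n with suc n % 3
... | zero        = refl
... | suc zero    = refl
... | suc (suc _) = refl

%3-digit : ∀ q (r : Fin 3) → (toℕ r + q * 3) % 3 ≡ toℕ r
%3-digit q r = trans ([m+kn]%n≡m%n (toℕ r) q 3) (m<n⇒m%n≡m (toℕ<n r))

/3-digit : ∀ q (r : Fin 3) → (toℕ r + q * 3) / 3 ≡ q
/3-digit q r = begin
  (toℕ r + q * 3) / 3     ≡⟨ +-distrib-/-∣ʳ (toℕ r) (n∣m*n q) ⟩
  toℕ r / 3 + q * 3 / 3   ≡⟨ cong₂ _+_ (m<n⇒m/n≡0 (toℕ<n r)) (m*n/n≡m q 3) ⟩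
  q                       ∎

t-aux-step-digit : ∀ f q (r : Fin 3) →
  t-aux-step ((toℕ r + q * 3) % 3) f (toℕ r + q * 3) ≡ (toℕ r ≡ᵇ 2) xor t-aux f (2 * q + ⌊ toℕ r /2⌋)
t-aux-step-digit f q r rewrite %3-digit q r with r
... | zero           rewrite /3-digit q zero = cong (t-aux f) (sym (+-identityʳ (2 * q)))
... | suc zero       rewrite /3-digit q (suc zero) = cong (t-aux f) (sym (+-identityʳ (2 * q)))
... | suc (suc zero) rewrite /3-digit q (suc (suc zero)) = refl

t-aux-unfold : ∀ f {n} q (r : Fin 3) → suc n ≡ toℕ r + q * 3 →
  t-aux (suc f) (suc n) ≡ (toℕ r ≡ᵇ 2) xor t-aux f (2 * q + ⌊ toℕ r /2⌋)
t-aux-unfold f {n} q r eq = begin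
  t-aux (suc f) (suc n)                              ≡⟨ t-aux-suc f n ⟩
  t-aux-step (suc n % 3) f (suc n)                   ≡⟨ cong (λ x → t-aux-step (x % 3) f x) eq ⟩
  t-aux-step ((toℕ r + q * 3) % 3) f (toℕ r + q * 3) ≡⟨ t-aux-step-digit f q r ⟩
  (toℕ r ≡ᵇ 2) xor t-aux f (2 * q + ⌊ toℕ r /2⌋)     ∎

digit-shrinks : ∀ q (r : Fin 3) → 2 * q + ⌊ toℕ r /2⌋ ≤ pred (toℕ r + q * 3)
digit-shrinks zero    zero                   = z≤n
digit-shrinks zero    (suc zero)             = z≤n
digit-shrinks zero    (suc (suc zero))       = s≤s z≤n
digit-shrinks (suc q) zero                   = ≤″⇒≤ (q , shrink₀ q)
  where shrink₀ : ∀ q → 2 * suc q + 0 + q ≡ 2 + q * 3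
        shrink₀ = solve-∀
digit-shrinks (suc q) (suc zero)             = ≤″⇒≤ (suc q , shrink₁ q)
  where shrink₁ : ∀ q → 2 * suc q + 0 + suc q ≡ suc q * 3
        shrink₁ = solve-∀
digit-shrinks (suc q) (suc (suc zero))       = ≤″⇒≤ (suc q , shrink₂ q)
  where shrink₂ : ∀ q → 2 * suc q + 1 + suc q ≡ 1 + suc q * 3
        shrink₂ = solve-∀

digit-shrinks-suc : ∀ {n} q (r : Fin 3) → suc n ≡ toℕ r + q * 3 → 2 * q + ⌊ toℕ r /2⌋ ≤ n
digit-shrinks-suc q r eq = subst (λ x → 2 * q + ⌊ toℕ r /2⌋ ≤ pred x) (sym eq) (digit-shrinks q r)

t-aux-fuel : ∀ {f f′ n} → n < f → n < f′ → t-aux f n ≡ t-aux f′ n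
t-aux-fuel {suc f} {suc f′} {zero}  _           _            = refl
t-aux-fuel {suc f} {suc f′} {suc n} (s≤s n<f) (s≤s n<f′) with suc n divMod 3
... | result q r eq = begin
  t-aux (suc f) (suc n)           ≡⟨ t-aux-unfold f q r eq ⟩
  δ xor t-aux f (2 * q + c)       ≡⟨ cong (δ xor_) (t-aux-fuel (≤-<-trans shrinks n<f) (≤-<-trans shrinks n<f′)) ⟩
  δ xor t-aux f′ (2 * q + c)      ≡⟨ t-aux-unfold f′ q r eq ⟨
  t-aux (suc f′) (suc n)          ∎
  where
  δ : Bool
  δ = toℕ r ≡ᵇ 2
  c : ℕ
  c = ⌊ toℕ r /2⌋
  shrinks : 2 * q + c ≤ n
  shrinks = digit-shrinks-suc q r eq

t-recurrence-suc : ∀ {n} q (r : Fin 3) → suc n ≡ toℕ r + q * 3 →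
  t (suc n) ≡ (toℕ r ≡ᵇ 2) xor t (2 * q + ⌊ toℕ r /2⌋)
t-recurrence-suc {n} q r eq = trans (t-aux-unfold (suc n) q r eq)
  (cong ((toℕ r ≡ᵇ 2) xor_) (t-aux-fuel (s≤s (digit-shrinks-suc q r eq)) ≤-refl))

t-recurrence : ∀ n (r : Fin 3) → t (toℕ r + n * 3) ≡ (toℕ r ≡ᵇ 2) xor t (2 * n + ⌊ toℕ r /2⌋)
t-recurrence zero    zero    = refl
t-recurrence (suc n) zero    = t-recurrence-suc (suc n) zero refl
t-recurrence n       (suc r) = t-recurrence-suc n (suc r) refl

t[3^g*m+j] : ∀ g m j → j ≤ g → t (3 ^ g * m + j) ≡ t j xor t (2 ^ g * m)
t[3^g*m+j] zero    m zero    _     = cong t (+-identityʳ (1 * m))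
t[3^g*m+j] zero    m (suc j) ()
t[3^g*m+j] (suc g) m j       j≤1+g with j divMod 3
... | result q r refl = begin
  t (3 ^ suc g * m + (toℕ r + q * 3))             ≡⟨ cong t (regroup₃ (3 ^ g) m (toℕ r) q) ⟩
  t (toℕ r + (3 ^ g * m + q) * 3)                 ≡⟨ t-recurrence (3 ^ g * m + q) r ⟩
  δ xor t (2 * (3 ^ g * m + q) + c)               ≡⟨ cong (λ k → δ xor t k) (regroup₂ (3 ^ g) m q c) ⟩
  δ xor t (3 ^ g * (2 * m) + (2 * q + c))         ≡⟨ cong (δ xor_) (t[3^g*m+j] g (2 * m) (2 * q + c) shrinks) ⟩
  δ xor (t (2 * q + c) xor t (2 ^ g * (2 * m)))   ≡⟨ xor-assoc δ _ _ ⟨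
  (δ xor t (2 * q + c)) xor t (2 ^ g * (2 * m))   ≡⟨ cong₂ _xor_ (t-recurrence q r) (cong t (double (2 ^ g) m)) ⟨
  t (toℕ r + q * 3) xor t (2 ^ suc g * m)         ∎
  where
  δ : Bool
  δ = toℕ r ≡ᵇ 2
  c : ℕ
  c = ⌊ toℕ r /2⌋
  shrinks : 2 * q + c ≤ g
  shrinks = ≤-trans (digit-shrinks q r) (pred-mono-≤ j≤1+g)
  regroup₃ : ∀ p m r q → 3 * p * m + (r + q * 3) ≡ r + (p * m + q) * 3
  regroup₃ = solve-∀
  regroup₂ : ∀ p m q c → 2 * (p * m + q) + c ≡ p * (2 * m) + (2 * q + c)
  regroup₂ = solve-∀
  double : ∀ p m → 2 * p * m ≡ p * (2 * m)
  double = solve-∀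

record Shift (d : ℕ) (b : Bool) (n : ℕ) : Set where
  constructor shifts
  field agree : ∀ j → j < n → t (d + j) ≡ t j xor b

3^g*m-shift : ∀ g m → Shift (3 ^ g * m) (t (2 ^ g * m)) (suc g)
3^g*m-shift g m = shifts λ j j<1+g → t[3^g*m+j] g m j (s≤s⁻¹ j<1+g)

3^g-shift : ∀ g → Shift (3 ^ g) (t (2 ^ g)) (suc g)
3^g-shift g = subst₂ (λ d b → Shift d b (suc g)) (*-identityʳ (3 ^ g)) (cong t (*-identityʳ (2 ^ g))) (3^g*m-shift g 1)

2*3^g-shift : ∀ g → Shift (2 * 3 ^ g) (t (2 ^ suc g)) (suc g)
2*3^g-shift g = subst₂ (λ d b → Shift d b (suc g)) (*-comm (3 ^ g) 2) (cong t (*-comm (2 ^ g) 2)) (3^g*m-shift g 2)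

Shift-restrict : ∀ {d b m n} → m ≤ n → Shift d b n → Shift d b m
Shift-restrict m≤n (shifts agree) = shifts λ j j<m → agree j (<-≤-trans j<m m≤n)

Shift-compose : ∀ {d b n d′ b′} → Shift d b n → Shift d′ b′ (d + n) → Shift (d′ + d) (b xor b′) n
Shift-compose {d} {b} {n} {d′} {b′} (shifts agree) (shifts agree′) = shifts λ j j<n → begin
  t (d′ + d + j)       ≡⟨ cong t (+-assoc d′ d j) ⟩
  t (d′ + (d + j))     ≡⟨ agree′ (d + j) (+-monoʳ-< d j<n) ⟩
  t (d + j) xor b′     ≡⟨ cong (_xor b′) (agree j j<n) ⟩
  (t j xor b) xor b′   ≡⟨ xor-assoc (t j) b b′ ⟩
  t j xor (b xor b′)   ∎

Shift-occurs : ∀ {d} u i → Shift d false (i + length u) → OccursAt u i → OccursAt u (d + i)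
Shift-occurs {d} u i (shifts agree) occ k = begin
  t (d + i + toℕ k)           ≡⟨ cong t (+-assoc d i (toℕ k)) ⟩
  t (d + (i + toℕ k))         ≡⟨ agree (i + toℕ k) (+-monoʳ-< i (toℕ<n k)) ⟩
  t (i + toℕ k) xor false     ≡⟨ xor-identityʳ (t (i + toℕ k)) ⟩
  t (i + toℕ k)               ≡⟨ occ k ⟩
  lookup u k                  ∎

Odd : ℕ → Set
Odd d = ∃ λ e → d ≡ suc (2 * e)

3^g-odd : ∀ g → Odd (3 ^ g)
3^g-odd zero    = 0 , refl
3^g-odd (suc g) with 3^g-odd g
... | e , eq = suc (3 * e) , trans (cong (3 *_) eq) (triple e)
  where triple : ∀ e → 3 * suc (2 * e) ≡ suc (2 * suc (3 * e))
        triple = solve-∀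

even+odd-odd : ∀ a {d} → Odd d → Odd (2 * a + d)
even+odd-odd a (e , refl) = a + e , regroup a e
  where regroup : ∀ a e → 2 * a + suc (2 * e) ≡ suc (2 * (a + e))
        regroup = solve-∀

OddShift : ℕ → Set
OddShift n = ∃ λ e → Shift (suc (2 * e)) false n

odd-shift : ∀ n → OddShift n
odd-shift n = pick (t (2 ^ n)) (t (2 ^ suc h)) s₁ s₂ (Shift-compose s₁ s₃)
  where
  h : ℕ
  h = 3 ^ n + n
  s₁ : Shift (3 ^ n) (t (2 ^ n)) n
  s₁ = Shift-restrict (n≤1+n n) (3^g-shift n)
  s₂ : Shift (3 ^ suc h) (t (2 ^ suc h)) n
  s₂ = Shift-restrict (m≤n⇒m≤1+n (m≤n⇒m≤1+n (m≤n+m n (3 ^ n)))) (3^g-shift (suc h))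
  s₃ : Shift (2 * 3 ^ h) (t (2 ^ suc h)) h
  s₃ = Shift-restrict (n≤1+n h) (2*3^g-shift h)
  odd : ∀ {d} → Odd d → Shift d false n → OddShift n
  odd (e , refl) shift = e , shift
  pick : ∀ b₁ b₂ → Shift (3 ^ n) b₁ n → Shift (3 ^ suc h) b₂ n → Shift (2 * 3 ^ h + 3 ^ n) (b₁ xor b₂) n → OddShift n
  pick false _     s _ _ = odd (3^g-odd n) s
  pick true  false _ s _ = odd (3^g-odd (suc h)) s
  pick true  true  _ _ s = odd (even+odd-odd (3 ^ h) (3^g-odd n)) s

even-or-odd : ∀ i → ∃ λ m → i ≡ 2 * m ⊎ i ≡ 2 * m + 1
even-or-odd zero = 0 , inj₁ refl
even-or-odd (suc i) with even-or-odd i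
... | m , inj₁ refl = m , inj₂ (+-comm 1 (2 * m))
... | m , inj₂ refl = suc m , inj₁ (+1+1 m)
  where +1+1 : ∀ m → suc (2 * m + 1) ≡ 2 * suc m
        +1+1 = solve-∀

proposition14 : (u : List Bool) → Factor u →
    (∃ λ m → OccursAt u (2 * m)) × (∃ λ m → OccursAt u (2 * m + 1))
proposition14 u (i , occ) with even-or-odd i | odd-shift (i + length u)
... | m , inj₁ refl | e , shift = (m , occ) , (e + m , subst (OccursAt u) (odd+even e m) (Shift-occurs u _ shift occ))
  where odd+even : ∀ e m → suc (2 * e) + 2 * m ≡ 2 * (e + m) + 1
        odd+even = solve-∀
... | m , inj₂ refl | e , shift = (suc (e + m) , subst (OccursAt u) (odd+odd e m) (Shift-occurs u _ shift occ)) , (m , occ)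
  where odd+odd : ∀ e m → suc (2 * e) + (2 * m + 1) ≡ 2 * suc (e + m)
        odd+odd = solve-∀
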